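{- Let $k$ be a natural number. For any formula $\varphi\in\Pi_{k+2}$ and any formula $\psi$ of prenex normal form, if $\mathsf{PA}\vdash\psi\to\varphi$, then $\mathsf{HA}+\mathrm{LEM}(\Sigma_k)\vdash\psi\to\varphi$.
   Context: $\mathsf{HA}$ is intuitionistic (Heyting) arithmetic in the language with function symbols for all primitive recursive functions and logical constants $\forall,\exists,\to,\land,\lor,\perp$; $\neg\varphi$ abbreviates $\varphi\to\perp$. $\mathsf{PA}$ is $\mathsf{HA}$ plus the law of excluded middle for all formulas. $\Sigma_0=\Pi_0$ is the class of quantifier-free formulas; $\Pi_{k+1}$ consists of formulas $Q_1\bar x_1\cdots Q_{k+1}\bar x_{k+1}\,\varphi_{qf}$ with $\varphi_{qf}$ quantifier-free, $Q_i=\forall$ for odd $i$ and $\exists$ for even $i$; $\Sigma_{k+1}$ likewise with $Q_i=\exists$ for odd $i$ and $\forall$ for even $i$ (blocks of like quantifiers). A formula is of prenex normal form if it is in $\Sigma_k\cup\Pi_k$ for some $k$. $\Gamma(x)$ is the set of formulas in $\Gamma$ whose free variables are among $x$. $\mathrm{LEM}(\Gamma)$ is the schema $\forall x(\varphi(x)\lor\neg\varphi(x))$ for $\varphi(x)\in\Gamma(x)$, and $\mathsf{HA}+\mathrm{LEM}(\Gamma)$ is $\mathsf{HA}$ with all its instances added. -}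

module Defs where

open import Data.Nat using (ℕ; zero; suc)
open import Data.Fin using (Fin)
open import Data.Vec using (Vec; []; _∷_; lookup)
import Data.Vec as V
open import Data.List using (List; []; _∷_)
import Data.List as L
open import Data.List.Membership.Propositional using (_∈_)
open import Data.Product using (∃; _×_)
open import Data.Sum using (_⊎_)
open import Data.Unit using (⊤)
open import Relation.Binary.PropositionalEquality using (_≡_)

-- Codes of primitive recursive functions (one function symbol each)

data PR : ℕ → Set where
  zeroF : PR 0
  succF : PR 1
  proj  : ∀ {n} → Fin n → PR n
  comp  : ∀ {m n} → PR m → Vec (PR n) m → PR n
  -- rec g h (0 , xs) = g xs ; rec g h (S y , xs) = h (y , rec g h (y , xs) , xs)
  rec   : ∀ {n} → PR n → PR (suc (suc n)) → PR (suc n)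

-- Terms and formulas (de Bruijn indices for variables)

data Term : Set where
  var : ℕ → Term
  app : ∀ {n} → PR n → Vec Term n → Term

𝟘 : Term
𝟘 = app zeroF []

S : Term → Term
S t = app succF (t ∷ [])

infixr 4 _⇒_
infixr 5 _∨'_
infixr 6 _∧'_
infix 7 _≐_

data Formula : Set where
  _≐_  : Term → Term → Formula
  ⊥'   : Formula
  _∧'_ : Formula → Formula → Formula
  _∨'_ : Formula → Formula → Formula
  _⇒_  : Formula → Formula → Formula
  ∀'   : Formula → Formula
  ∃'   : Formula → Formula

¬' : Formula → Formula
¬' φ = φ ⇒ ⊥'

Subst : Set
Subst = ℕ → Term

mutual
  tsub : Subst → Term → Term
  tsub σ (var i)   = σ i
  tsub σ (app f ts) = app f (tsubs σ ts)

  tsubs : ∀ {n} → Subst → Vec Term n → Vec Term n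
  tsubs σ []       = []
  tsubs σ (t ∷ ts) = tsub σ t ∷ tsubs σ ts

shiftT : Term → Term
shiftT = tsub (λ i → var (suc i))

lift : Subst → Subst
lift σ zero    = var zero
lift σ (suc i) = shiftT (σ i)

fsub : Subst → Formula → Formula
fsub σ (s ≐ t)  = tsub σ s ≐ tsub σ t
fsub σ ⊥'       = ⊥'
fsub σ (φ ∧' ψ) = fsub σ φ ∧' fsub σ ψ
fsub σ (φ ∨' ψ) = fsub σ φ ∨' fsub σ ψ
fsub σ (φ ⇒ ψ)  = fsub σ φ ⇒ fsub σ ψ
fsub σ (∀' φ)   = ∀' (fsub (lift σ) φ)
fsub σ (∃' φ)   = ∃' (fsub (lift σ) φ)

shift : Formula → Formula
shift = fsub (λ i → var (suc i))

-- substitute t for variable 0 (other free variables move down by one)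
sub0 : Term → Subst
sub0 t zero    = t
sub0 t (suc i) = var i

_[_] : Formula → Term → Formula
φ [ t ] = fsub (sub0 t) φ

stepSub : Subst
stepSub zero    = S (var zero)
stepSub (suc i) = var (suc i)

Theory : Set₁
Theory = Formula → Set

_∪_ : Theory → Theory → Theory
(T ∪ U) φ = T φ ⊎ U φ

data Prf (T : Theory) : List Formula → Formula → Set where
  ax   : ∀ {Γ φ} → T φ → Prf T Γ φ
  hyp  : ∀ {Γ φ} → φ ∈ Γ → Prf T Γ φ
  ⊥E   : ∀ {Γ φ} → Prf T Γ ⊥' → Prf T Γ φ
  ∧I   : ∀ {Γ φ ψ} → Prf T Γ φ → Prf T Γ ψ → Prf T Γ (φ ∧' ψ)
  ∧E₁  : ∀ {Γ φ ψ} → Prf T Γ (φ ∧' ψ) → Prf T Γ φ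
  ∧E₂  : ∀ {Γ φ ψ} → Prf T Γ (φ ∧' ψ) → Prf T Γ ψ
  ∨I₁  : ∀ {Γ φ ψ} → Prf T Γ φ → Prf T Γ (φ ∨' ψ)
  ∨I₂  : ∀ {Γ φ ψ} → Prf T Γ ψ → Prf T Γ (φ ∨' ψ)
  ∨E   : ∀ {Γ φ ψ χ} → Prf T Γ (φ ∨' ψ) → Prf T (φ ∷ Γ) χ → Prf T (ψ ∷ Γ) χ
         → Prf T Γ χ
  ⇒I   : ∀ {Γ φ ψ} → Prf T (φ ∷ Γ) ψ → Prf T Γ (φ ⇒ ψ)
  ⇒E   : ∀ {Γ φ ψ} → Prf T Γ (φ ⇒ ψ) → Prf T Γ φ → Prf T Γ ψ
  -- eigenvariable condition: the context is shifted, so var 0 is fresh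
  ∀I   : ∀ {Γ φ} → Prf T (L.map shift Γ) φ → Prf T Γ (∀' φ)
  ∀E   : ∀ {Γ φ} (t : Term) → Prf T Γ (∀' φ) → Prf T Γ (φ [ t ])
  ∃I   : ∀ {Γ φ} (t : Term) → Prf T Γ (φ [ t ]) → Prf T Γ (∃' φ)
  ∃E   : ∀ {Γ φ ψ} → Prf T Γ (∃' φ) → Prf T (φ ∷ L.map shift Γ) (shift ψ)
         → Prf T Γ ψ

_⊢_ : Theory → Formula → Set
T ⊢ φ = Prf T [] φ

-- Heyting arithmetic (free variables of axioms are implicitly universal;
-- all schemata are instantiated over arbitrary terms / formulas)

data HAax : Theory where
  eq-refl  : ∀ t → HAax (t ≐ t)
  eq-subst : ∀ φ s t → HAax (s ≐ t ⇒ φ [ s ] ⇒ φ [ t ])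
  succ-nz  : ∀ t → HAax (¬' (S t ≐ 𝟘))
  succ-inj : ∀ s t → HAax (S s ≐ S t ⇒ s ≐ t)
  proj-def : ∀ {n} (i : Fin n) (ts : Vec Term n) →
             HAax (app (proj i) ts ≐ lookup ts i)
  comp-def : ∀ {m n} (g : PR m) (hs : Vec (PR n) m) (ts : Vec Term n) →
             HAax (app (comp g hs) ts ≐ app g (V.map (λ h → app h ts) hs))
  rec-def₀ : ∀ {n} (g : PR n) (h : PR (suc (suc n))) (ts : Vec Term n) →
             HAax (app (rec g h) (𝟘 ∷ ts) ≐ app g ts)
  rec-defS : ∀ {n} (g : PR n) (h : PR (suc (suc n))) (t : Term) (ts : Vec Term n) →
             HAax (app (rec g h) (S t ∷ ts) ≐ app h (t ∷ app (rec g h) (t ∷ ts) ∷ ts))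
  ind      : ∀ φ → HAax (φ [ 𝟘 ] ⇒ ∀' (φ ⇒ fsub stepSub φ) ⇒ ∀' φ)

HA : Theory
HA = HAax

data QF : Formula → Set where
  qf-eq  : ∀ s t → QF (s ≐ t)
  qf-⊥   : QF ⊥'
  qf-∧   : ∀ {φ ψ} → QF φ → QF ψ → QF (φ ∧' ψ)
  qf-∨   : ∀ {φ ψ} → QF φ → QF ψ → QF (φ ∨' ψ)
  qf-⇒   : ∀ {φ ψ} → QF φ → QF ψ → QF (φ ⇒ ψ)

-- Σ_k / Π_k : alternating blocks of like quantifiers in front of a
-- quantifier-free matrix (a block may consist of several quantifiers).
mutual
  data Σ-form : ℕ → Formula → Set where
    Σ-qf    : ∀ {φ} → QF φ → Σ-form zero φ
    Σ-block : ∀ {k φ} → Π-form k φ → Σ-form (suc k) φ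
    Σ-∃     : ∀ {k φ} → Σ-form (suc k) φ → Σ-form (suc k) (∃' φ)

  data Π-form : ℕ → Formula → Set where
    Π-qf    : ∀ {φ} → QF φ → Π-form zero φ
    Π-block : ∀ {k φ} → Σ-form k φ → Π-form (suc k) φ
    Π-∀     : ∀ {k φ} → Π-form (suc k) φ → Π-form (suc k) (∀' φ)

Prenex : Formula → Set
Prenex φ = ∃ λ k → Σ-form k φ ⊎ Π-form k φ

LEM : (Formula → Set) → Theory
LEM Γ χ = ∃ λ φ → Γ φ × (χ ≡ (φ ∨' ¬' φ))

AllFormulas : Formula → Set
AllFormulas _ = ⊤

PA : Theory
PA = HA ∪ LEM AllFormulas

{-# OPTIONS --safe #-}
-- Friedman's A-translation with A the conclusion φ itself. A PA-proof of
-- ψ ⇒ φ becomes an HA-proof of ψᴬ ⇒ φᴬ, where χᴬ is the negative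
-- translation of χ with ⊥ read as A. Over HA + LEM(Σₖ) a prenex ψ implies
-- ψᴬ (excluded middle for quantifier-free formulas suffices), and for φ in
-- Σₖ₊₁, φᴬ implies (φ ⇒ A) ⇒ A: the existential block commutes with the
-- double A-negation, and the Πₖ matrix can be split by LEM(Σₖ) into itself
-- or its classical dual. Taking A = φ gives ψ ⇒ φ. A Πₖ₊₂ conclusion is a
-- universal block over a Σₖ₊₁ formula, which is stripped and restored.
module Submission where

open import Defs
open import Data.Nat using (ℕ; zero; suc; _≤_; _≤′_; ≤′-refl; ≤′-step)
open import Data.Nat.Properties using (≤⇒≤′; ≤-pred; <⇒≤; ≤-refl; m≤n⇒m≤1+n)
import Data.Fin as F
open import Data.Vec using (Vec; []; _∷_; lookup)
import Data.Vec as V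
open import Data.List using ([]; _∷_; map)
open import Data.List.Properties using (map-∘; map-cong)
open import Data.List.Membership.Propositional.Properties using (∈-map⁺)
open import Data.List.Relation.Binary.Subset.Propositional using (_⊆_)
open import Data.List.Relation.Binary.Subset.Propositional.Properties using (map⁺; ∷⁺ʳ)
open import Data.List.Relation.Unary.Any using (here; there)
open import Data.Product using (_,_)
open import Data.Sum using (inj₁; inj₂)
open import Data.Unit using (tt)
open import Relation.Binary.PropositionalEquality
  using (_≡_; refl; sym; trans; cong; cong₂; subst; subst₂; module ≡-Reasoning)

↑ : Subst
↑ i = var (suc i)

mutual
  tsub-cong : ∀ {σ τ} → (∀ i → σ i ≡ τ i) → ∀ t → tsub σ t ≡ tsub τ t
  tsub-cong e (var i)    = e i
  tsub-cong e (app f ts) = cong (app f) (tsubs-cong e ts)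

  tsubs-cong : ∀ {n σ τ} → (∀ i → σ i ≡ τ i) → (ts : Vec Term n) → tsubs σ ts ≡ tsubs τ ts
  tsubs-cong e []       = refl
  tsubs-cong e (t ∷ ts) = cong₂ _∷_ (tsub-cong e t) (tsubs-cong e ts)

mutual
  tsub-∘ : ∀ σ τ t → tsub σ (tsub τ t) ≡ tsub (λ i → tsub σ (τ i)) t
  tsub-∘ σ τ (var i)    = refl
  tsub-∘ σ τ (app f ts) = cong (app f) (tsubs-∘ σ τ ts)

  tsubs-∘ : ∀ {n} σ τ (ts : Vec Term n) → tsubs σ (tsubs τ ts) ≡ tsubs (λ i → tsub σ (τ i)) ts
  tsubs-∘ σ τ []       = refl
  tsubs-∘ σ τ (t ∷ ts) = cong₂ _∷_ (tsub-∘ σ τ t) (tsubs-∘ σ τ ts)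

mutual
  tsub-id : ∀ {σ} → (∀ i → σ i ≡ var i) → ∀ t → tsub σ t ≡ t
  tsub-id e (var i)    = e i
  tsub-id e (app f ts) = cong (app f) (tsubs-id e ts)

  tsubs-id : ∀ {n σ} → (∀ i → σ i ≡ var i) → (ts : Vec Term n) → tsubs σ ts ≡ ts
  tsubs-id e []       = refl
  tsubs-id e (t ∷ ts) = cong₂ _∷_ (tsub-id e t) (tsubs-id e ts)

shiftT-sub0 : ∀ u t → tsub (sub0 u) (shiftT t) ≡ t
shiftT-sub0 u t = trans (tsub-∘ (sub0 u) ↑ t) (tsub-id (λ _ → refl) t)

lift-cong : ∀ {σ τ} → (∀ i → σ i ≡ τ i) → ∀ i → lift σ i ≡ lift τ i
lift-cong e zero    = refl
lift-cong e (suc i) = cong shiftT (e i)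

fsub-cong : ∀ {σ τ} → (∀ i → σ i ≡ τ i) → ∀ φ → fsub σ φ ≡ fsub τ φ
fsub-cong e (s ≐ t)  = cong₂ _≐_ (tsub-cong e s) (tsub-cong e t)
fsub-cong e ⊥'       = refl
fsub-cong e (φ ∧' ψ) = cong₂ _∧'_ (fsub-cong e φ) (fsub-cong e ψ)
fsub-cong e (φ ∨' ψ) = cong₂ _∨'_ (fsub-cong e φ) (fsub-cong e ψ)
fsub-cong e (φ ⇒ ψ)  = cong₂ _⇒_ (fsub-cong e φ) (fsub-cong e ψ)
fsub-cong e (∀' φ)   = cong ∀' (fsub-cong (lift-cong e) φ)
fsub-cong e (∃' φ)   = cong ∃' (fsub-cong (lift-cong e) φ)

lift-∘ : ∀ σ τ i → tsub (lift σ) (lift τ i) ≡ lift (λ j → tsub σ (τ j)) i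
lift-∘ σ τ zero    = refl
lift-∘ σ τ (suc i) = trans (tsub-∘ (lift σ) ↑ (τ i)) (sym (tsub-∘ ↑ σ (τ i)))

fsub-∘ : ∀ σ τ φ → fsub σ (fsub τ φ) ≡ fsub (λ i → tsub σ (τ i)) φ
fsub-∘ σ τ (s ≐ t)  = cong₂ _≐_ (tsub-∘ σ τ s) (tsub-∘ σ τ t)
fsub-∘ σ τ ⊥'       = refl
fsub-∘ σ τ (φ ∧' ψ) = cong₂ _∧'_ (fsub-∘ σ τ φ) (fsub-∘ σ τ ψ)
fsub-∘ σ τ (φ ∨' ψ) = cong₂ _∨'_ (fsub-∘ σ τ φ) (fsub-∘ σ τ ψ)
fsub-∘ σ τ (φ ⇒ ψ)  = cong₂ _⇒_ (fsub-∘ σ τ φ) (fsub-∘ σ τ ψ)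
fsub-∘ σ τ (∀' φ)   = cong ∀' (trans (fsub-∘ (lift σ) (lift τ) φ) (fsub-cong (lift-∘ σ τ) φ))
fsub-∘ σ τ (∃' φ)   = cong ∃' (trans (fsub-∘ (lift σ) (lift τ) φ) (fsub-cong (lift-∘ σ τ) φ))

lift-id : ∀ {σ} → (∀ i → σ i ≡ var i) → ∀ i → lift σ i ≡ var i
lift-id e zero    = refl
lift-id e (suc i) = cong shiftT (e i)

fsub-id : ∀ {σ} → (∀ i → σ i ≡ var i) → ∀ φ → fsub σ φ ≡ φ
fsub-id e (s ≐ t)  = cong₂ _≐_ (tsub-id e s) (tsub-id e t)
fsub-id e ⊥'       = refl
fsub-id e (φ ∧' ψ) = cong₂ _∧'_ (fsub-id e φ) (fsub-id e ψ)
fsub-id e (φ ∨' ψ) = cong₂ _∨'_ (fsub-id e φ) (fsub-id e ψ)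
fsub-id e (φ ⇒ ψ)  = cong₂ _⇒_ (fsub-id e φ) (fsub-id e ψ)
fsub-id e (∀' φ)   = cong ∀' (fsub-id (lift-id e) φ)
fsub-id e (∃' φ)   = cong ∃' (fsub-id (lift-id e) φ)

fsub-∘-cong : ∀ {σ τ σ′ τ′} → (∀ i → tsub σ (τ i) ≡ tsub σ′ (τ′ i)) →
              ∀ φ → fsub σ (fsub τ φ) ≡ fsub σ′ (fsub τ′ φ)
fsub-∘-cong {σ} {τ} {σ′} {τ′} e φ = begin
  fsub σ (fsub τ φ)                 ≡⟨ fsub-∘ σ τ φ ⟩
  fsub (λ i → tsub σ (τ i)) φ       ≡⟨ fsub-cong e φ ⟩
  fsub (λ i → tsub σ′ (τ′ i)) φ     ≡⟨ sym (fsub-∘ σ′ τ′ φ) ⟩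
  fsub σ′ (fsub τ′ φ)               ∎
  where open ≡-Reasoning

fsub-∘-id : ∀ {σ τ} → (∀ i → tsub σ (τ i) ≡ var i) → ∀ φ → fsub σ (fsub τ φ) ≡ φ
fsub-∘-id {σ} {τ} e φ = trans (fsub-∘ σ τ φ) (fsub-id e φ)

shift-[] : ∀ φ t → shift φ [ t ] ≡ φ
shift-[] φ t = fsub-∘-id (λ _ → refl) φ

lift↑-[var0] : ∀ φ → fsub (lift ↑) φ [ var zero ] ≡ φ
lift↑-[var0] = fsub-∘-id e
  where
  e : ∀ i → tsub (sub0 (var zero)) (lift ↑ i) ≡ var i
  e zero    = refl
  e (suc i) = refl

fsub-lift-shift : ∀ σ φ → fsub (lift σ) (shift φ) ≡ shift (fsub σ φ)
fsub-lift-shift σ = fsub-∘-cong (λ _ → refl)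

stepSub-shift : ∀ φ → fsub stepSub (shift φ) ≡ shift φ
stepSub-shift = fsub-∘ stepSub ↑

fsub-[] : ∀ σ t φ → fsub σ (φ [ t ]) ≡ fsub (lift σ) φ [ tsub σ t ]
fsub-[] σ t = fsub-∘-cong e
  where
  e : ∀ i → tsub σ (sub0 t i) ≡ tsub (sub0 (tsub σ t)) (lift σ i)
  e zero    = refl
  e (suc i) = sym (shiftT-sub0 (tsub σ t) (σ i))

fsub-stepSub : ∀ σ φ → fsub (lift σ) (fsub stepSub φ) ≡ fsub stepSub (fsub (lift σ) φ)
fsub-stepSub σ = fsub-∘-cong e
  where
  e : ∀ i → tsub (lift σ) (stepSub i) ≡ tsub stepSub (lift σ i)
  e zero    = refl
  e (suc i) = sym (tsub-∘ stepSub ↑ (σ i))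

QF-fsub : ∀ σ {χ} → QF χ → QF (fsub σ χ)
QF-fsub σ (qf-eq s t) = qf-eq _ _
QF-fsub σ qf-⊥        = qf-⊥
QF-fsub σ (qf-∧ a b)  = qf-∧ (QF-fsub σ a) (QF-fsub σ b)
QF-fsub σ (qf-∨ a b)  = qf-∨ (QF-fsub σ a) (QF-fsub σ b)
QF-fsub σ (qf-⇒ a b)  = qf-⇒ (QF-fsub σ a) (QF-fsub σ b)

mutual
  Σ-fsub : ∀ σ {m χ} → Σ-form m χ → Σ-form m (fsub σ χ)
  Σ-fsub σ (Σ-qf q)    = Σ-qf (QF-fsub σ q)
  Σ-fsub σ (Σ-block p) = Σ-block (Π-fsub σ p)
  Σ-fsub σ (Σ-∃ s)     = Σ-∃ (Σ-fsub (lift σ) s)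

  Π-fsub : ∀ σ {m χ} → Π-form m χ → Π-form m (fsub σ χ)
  Π-fsub σ (Π-qf q)    = Π-qf (QF-fsub σ q)
  Π-fsub σ (Π-block s) = Π-block (Σ-fsub σ s)
  Π-fsub σ (Π-∀ p)     = Π-∀ (Π-fsub (lift σ) p)

Prenex-fsub : ∀ σ {χ} → Prenex χ → Prenex (fsub σ χ)
Prenex-fsub σ (m , inj₁ s) = m , inj₁ (Σ-fsub σ s)
Prenex-fsub σ (m , inj₂ p) = m , inj₂ (Π-fsub σ p)

mutual
  Σ-suc : ∀ {m χ} → Σ-form m χ → Σ-form (suc m) χ
  Σ-suc (Σ-qf q)    = Σ-block (Π-qf q)
  Σ-suc (Σ-block p) = Σ-block (Π-suc p)
  Σ-suc (Σ-∃ s)     = Σ-∃ (Σ-suc s)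

  Π-suc : ∀ {m χ} → Π-form m χ → Π-form (suc m) χ
  Π-suc (Π-qf q)    = Π-block (Σ-qf q)
  Π-suc (Π-block s) = Π-block (Σ-suc s)
  Π-suc (Π-∀ p)     = Π-∀ (Π-suc p)

Σ-mono′ : ∀ {m n χ} → m ≤′ n → Σ-form m χ → Σ-form n χ
Σ-mono′ ≤′-refl        s = s
Σ-mono′ (≤′-step m≤′n) s = Σ-suc (Σ-mono′ m≤′n s)

Σ-mono : ∀ {m n χ} → m ≤ n → Σ-form m χ → Σ-form n χ
Σ-mono m≤n = Σ-mono′ (≤⇒≤′ m≤n)

mutual
  QF⇒Σ : ∀ {m χ} → QF χ → Σ-form m χ
  QF⇒Σ {zero}  q = Σ-qf q
  QF⇒Σ {suc m} q = Σ-block (QF⇒Π q)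

  QF⇒Π : ∀ {m χ} → QF χ → Π-form m χ
  QF⇒Π {zero}  q = Π-qf q
  QF⇒Π {suc m} q = Π-block (QF⇒Σ q)

dual : Formula → Formula
dual (∀' φ) = ∃' (dual φ)
dual (∃' φ) = ∀' (dual φ)
dual φ      = ¬' φ

dual-QF : ∀ {χ} → QF χ → QF (dual χ)
dual-QF (qf-eq s t) = qf-⇒ (qf-eq s t) qf-⊥
dual-QF qf-⊥        = qf-⇒ qf-⊥ qf-⊥
dual-QF (qf-∧ a b)  = qf-⇒ (qf-∧ a b) qf-⊥
dual-QF (qf-∨ a b)  = qf-⇒ (qf-∨ a b) qf-⊥
dual-QF (qf-⇒ a b)  = qf-⇒ (qf-⇒ a b) qf-⊥

mutual
  dual-Σ : ∀ {m χ} → Σ-form m χ → Π-form m (dual χ)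
  dual-Σ (Σ-qf q)    = Π-qf (dual-QF q)
  dual-Σ (Σ-block p) = Π-block (dual-Π p)
  dual-Σ (Σ-∃ s)     = Π-∀ (dual-Σ s)

  dual-Π : ∀ {m χ} → Π-form m χ → Σ-form m (dual χ)
  dual-Π (Π-qf q)    = Σ-qf (dual-QF q)
  dual-Π (Π-block s) = Σ-block (dual-Σ s)
  dual-Π (Π-∀ p)     = Σ-∃ (dual-Π p)

weaken : ∀ {T Γ Δ χ} → Γ ⊆ Δ → Prf T Γ χ → Prf T Δ χ
weaken s (ax a)     = ax a
weaken s (hyp m)    = hyp (s m)
weaken s (⊥E p)     = ⊥E (weaken s p)
weaken s (∧I p q)   = ∧I (weaken s p) (weaken s q)
weaken s (∧E₁ p)    = ∧E₁ (weaken s p)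
weaken s (∧E₂ p)    = ∧E₂ (weaken s p)
weaken s (∨I₁ p)    = ∨I₁ (weaken s p)
weaken s (∨I₂ p)    = ∨I₂ (weaken s p)
weaken s (∨E p q r) = ∨E (weaken s p) (weaken (∷⁺ʳ _ s) q) (weaken (∷⁺ʳ _ s) r)
weaken s (⇒I p)     = ⇒I (weaken (∷⁺ʳ _ s) p)
weaken s (⇒E p q)   = ⇒E (weaken s p) (weaken s q)
weaken s (∀I p)     = ∀I (weaken (map⁺ shift s) p)
weaken s (∀E t p)   = ∀E t (weaken s p)
weaken s (∃I t p)   = ∃I t (weaken s p)
weaken s (∃E p q)   = ∃E (weaken s p) (weaken (∷⁺ʳ _ (map⁺ shift s)) q)

weaken-[] : ∀ {T Γ χ} → T ⊢ χ → Prf T Γ χ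
weaken-[] = weaken (λ ())

weaken-∷ : ∀ {T Γ a χ} → Prf T Γ χ → Prf T (a ∷ Γ) χ
weaken-∷ = weaken there

weaken-∷∷ : ∀ {T Γ a b c χ} → Prf T (a ∷ Γ) χ → Prf T (a ∷ b ∷ c ∷ Γ) χ
weaken-∷∷ = weaken (∷⁺ʳ _ (λ m → there (there m)))

apply : ∀ {T Γ a b} → T ⊢ (a ⇒ b) → Prf T Γ a → Prf T Γ b
apply p q = ⇒E (weaken-[] p) q

#0 : ∀ {T Γ a} → Prf T (a ∷ Γ) a
#0 = hyp (here refl)

#1 : ∀ {T Γ a b} → Prf T (b ∷ a ∷ Γ) a
#1 = hyp (there (here refl))

#2 : ∀ {T Γ a b c} → Prf T (c ∷ b ∷ a ∷ Γ) a
#2 = hyp (there (there (here refl)))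

#3 : ∀ {T Γ a b c d} → Prf T (d ∷ c ∷ b ∷ a ∷ Γ) a
#3 = hyp (there (there (there (here refl))))

∀E-var0 : ∀ {T Γ φ} → Prf T Γ (∀' (fsub (lift ↑) φ)) → Prf T Γ φ
∀E-var0 {T} {Γ} {φ} p = subst (Prf T Γ) (lift↑-[var0] φ) (∀E (var zero) p)

∃I-var0 : ∀ {T Γ φ} → Prf T Γ φ → Prf T Γ (∃' (fsub (lift ↑) φ))
∃I-var0 {T} {Γ} {φ} p = ∃I (var zero) (subst (Prf T Γ) (sym (lift↑-[var0] φ)) p)

map-commute : ∀ {f g h k : Formula → Formula} → (∀ x → f (g x) ≡ h (k x)) →
              ∀ xs → map f (map g xs) ≡ map h (map k xs)
map-commute e xs = trans (sym (map-∘ xs)) (trans (map-cong e xs) (map-∘ xs))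

SubstClosed : Theory → Set
SubstClosed T = ∀ σ {φ} → T φ → T (fsub σ φ)

Prf-fsub : ∀ {T Γ χ} → SubstClosed T → ∀ σ → Prf T Γ χ → Prf T (map (fsub σ) Γ) (fsub σ χ)
Prf-fsub cl σ (ax a)     = ax (cl σ a)
Prf-fsub cl σ (hyp m)    = hyp (∈-map⁺ (fsub σ) m)
Prf-fsub cl σ (⊥E p)     = ⊥E (Prf-fsub cl σ p)
Prf-fsub cl σ (∧I p q)   = ∧I (Prf-fsub cl σ p) (Prf-fsub cl σ q)
Prf-fsub cl σ (∧E₁ p)    = ∧E₁ (Prf-fsub cl σ p)
Prf-fsub cl σ (∧E₂ p)    = ∧E₂ (Prf-fsub cl σ p)
Prf-fsub cl σ (∨I₁ p)    = ∨I₁ (Prf-fsub cl σ p)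
Prf-fsub cl σ (∨I₂ p)    = ∨I₂ (Prf-fsub cl σ p)
Prf-fsub cl σ (∨E p q r) = ∨E (Prf-fsub cl σ p) (Prf-fsub cl σ q) (Prf-fsub cl σ r)
Prf-fsub cl σ (⇒I p)     = ⇒I (Prf-fsub cl σ p)
Prf-fsub cl σ (⇒E p q)   = ⇒E (Prf-fsub cl σ p) (Prf-fsub cl σ q)
Prf-fsub {T} {Γ} cl σ (∀I {φ = φ} p) =
  ∀I (subst (λ Δ → Prf T Δ (fsub (lift σ) φ))
            (map-commute (fsub-lift-shift σ) Γ) (Prf-fsub cl (lift σ) p))
Prf-fsub {T} cl σ (∀E {φ = φ} t p) =
  subst (Prf T _) (sym (fsub-[] σ t φ)) (∀E (tsub σ t) (Prf-fsub cl σ p))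
Prf-fsub {T} cl σ (∃I {φ = φ} t p) =
  ∃I (tsub σ t) (subst (Prf T _) (fsub-[] σ t φ) (Prf-fsub cl σ p))
Prf-fsub {T} {Γ} cl σ (∃E {φ = φ} {ψ = ψ} p q) =
  ∃E (Prf-fsub cl σ p)
     (subst₂ (λ Δ c → Prf T (fsub (lift σ) φ ∷ Δ) c)
             (map-commute (fsub-lift-shift σ) Γ) (fsub-lift-shift σ ψ) (Prf-fsub cl (lift σ) q))

⇒∀⁻ : ∀ {T ψ φ} → SubstClosed T → T ⊢ (ψ ⇒ ∀' φ) → T ⊢ (shift ψ ⇒ φ)
⇒∀⁻ cl d = ⇒I (∀E-var0 (⇒E (weaken-[] (Prf-fsub cl ↑ d)) #0))

⇒∀⁺ : ∀ {T ψ φ} → T ⊢ (shift ψ ⇒ φ) → T ⊢ (ψ ⇒ ∀' φ)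
⇒∀⁺ d = ⇒I (∀I (apply d #0))

lookup-tsubs : ∀ {n} σ (ts : Vec Term n) i → tsub σ (lookup ts i) ≡ lookup (tsubs σ ts) i
lookup-tsubs σ (t ∷ ts) F.zero    = refl
lookup-tsubs σ (t ∷ ts) (F.suc i) = lookup-tsubs σ ts i

tsubs-map-app : ∀ {m n} σ (ts : Vec Term n) (hs : Vec (PR n) m) →
                tsubs σ (V.map (λ h → app h ts) hs) ≡ V.map (λ h → app h (tsubs σ ts)) hs
tsubs-map-app σ ts []       = refl
tsubs-map-app σ ts (h ∷ hs) = cong (app h (tsubs σ ts) ∷_) (tsubs-map-app σ ts hs)

HA-fsub : SubstClosed HA
HA-fsub σ (eq-refl t) = eq-refl (tsub σ t)
HA-fsub σ (eq-subst φ s t) =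
  subst HAax (sym (cong₂ (λ a b → tsub σ s ≐ tsub σ t ⇒ a ⇒ b) (fsub-[] σ s φ) (fsub-[] σ t φ)))
        (eq-subst (fsub (lift σ) φ) (tsub σ s) (tsub σ t))
HA-fsub σ (succ-nz t)    = succ-nz (tsub σ t)
HA-fsub σ (succ-inj s t) = succ-inj (tsub σ s) (tsub σ t)
HA-fsub σ (proj-def i ts) =
  subst (λ u → HAax (app (proj i) (tsubs σ ts) ≐ u)) (sym (lookup-tsubs σ ts i))
        (proj-def i (tsubs σ ts))
HA-fsub σ (comp-def g hs ts) =
  subst (λ u → HAax (app (comp g hs) (tsubs σ ts) ≐ app g u)) (sym (tsubs-map-app σ ts hs))
        (comp-def g hs (tsubs σ ts))
HA-fsub σ (rec-def₀ g h ts)   = rec-def₀ g h (tsubs σ ts)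
HA-fsub σ (rec-defS g h t ts) = rec-defS g h (tsub σ t) (tsubs σ ts)
HA-fsub σ (ind φ) =
  subst HAax (sym (cong₂ (λ a b → a ⇒ ∀' (φσ ⇒ b) ⇒ ∀' φσ) (fsub-[] σ 𝟘 φ) (fsub-stepSub σ φ)))
        (ind φσ)
  where φσ = fsub (lift σ) φ

PA-fsub : SubstClosed PA
PA-fsub σ (inj₁ a)                = inj₁ (HA-fsub σ a)
PA-fsub σ (inj₂ (φ , tt , refl)) = inj₂ (fsub σ φ , tt , refl)

¬¬[_]_ : Formula → Formula → Formula
¬¬[ A ] χ = (χ ⇒ A) ⇒ A

¬¬-join : ∀ {T Γ} A χ → Prf T Γ (¬¬[ A ] ¬¬[ A ] χ ⇒ ¬¬[ A ] χ)
¬¬-join A χ = ⇒I (⇒I (⇒E #1 (⇒I (⇒E #0 #1))))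

dual⇒¬ : ∀ {T} χ → T ⊢ (dual χ ⇒ ¬' χ)
dual⇒¬ (s ≐ t)  = ⇒I #0
dual⇒¬ ⊥'       = ⇒I #0
dual⇒¬ (φ ∧' ψ) = ⇒I #0
dual⇒¬ (φ ∨' ψ) = ⇒I #0
dual⇒¬ (φ ⇒ ψ)  = ⇒I #0
dual⇒¬ (∀' φ)   = ⇒I (⇒I (∃E #1 (⇒E (apply (dual⇒¬ φ) #0) (∀E-var0 #1))))
dual⇒¬ (∃' φ)   = ⇒I (⇒I (∃E #0 (⇒E (apply (dual⇒¬ φ) (∀E-var0 #2)) #0)))

¬⇒dual-QF : ∀ {T χ} → QF χ → T ⊢ (¬' χ ⇒ dual χ)
¬⇒dual-QF (qf-eq s t) = ⇒I #0
¬⇒dual-QF qf-⊥        = ⇒I #0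
¬⇒dual-QF (qf-∧ a b)  = ⇒I #0
¬⇒dual-QF (qf-∨ a b)  = ⇒I #0
¬⇒dual-QF (qf-⇒ a b)  = ⇒I #0

-- The Gödel–Gentzen negative translation with ⊥ read as A; the bound
-- variables of χ are kept apart from the free ones of A by shifting A.
friedman : Formula → Formula → Formula
friedman A (s ≐ t)  = ¬¬[ A ] (s ≐ t)
friedman A ⊥'       = A
friedman A (φ ∧' ψ) = friedman A φ ∧' friedman A ψ
friedman A (φ ∨' ψ) = ¬¬[ A ] (friedman A φ ∨' friedman A ψ)
friedman A (φ ⇒ ψ)  = friedman A φ ⇒ friedman A ψ
friedman A (∀' φ)   = ∀' (friedman (shift A) φ)
friedman A (∃' φ)   = ¬¬[ A ] ∃' (friedman (shift A) φ)

mutual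
  fsub-friedman : ∀ σ A χ → fsub σ (friedman A χ) ≡ friedman (fsub σ A) (fsub σ χ)
  fsub-friedman σ A (s ≐ t)  = refl
  fsub-friedman σ A ⊥'       = refl
  fsub-friedman σ A (φ ∧' ψ) = cong₂ _∧'_ (fsub-friedman σ A φ) (fsub-friedman σ A ψ)
  fsub-friedman σ A (φ ∨' ψ) =
    cong₂ (λ a b → ¬¬[ fsub σ A ] (a ∨' b)) (fsub-friedman σ A φ) (fsub-friedman σ A ψ)
  fsub-friedman σ A (φ ⇒ ψ)  = cong₂ _⇒_ (fsub-friedman σ A φ) (fsub-friedman σ A ψ)
  fsub-friedman σ A (∀' φ)   = cong ∀' (fsub-friedman-lift σ A φ)
  fsub-friedman σ A (∃' φ)   = cong (λ a → ¬¬[ fsub σ A ] ∃' a) (fsub-friedman-lift σ A φ)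

  fsub-friedman-lift : ∀ σ A φ →
    fsub (lift σ) (friedman (shift A) φ) ≡ friedman (shift (fsub σ A)) (fsub (lift σ) φ)
  fsub-friedman-lift σ A φ =
    trans (fsub-friedman (lift σ) (shift A) φ)
          (cong (λ B → friedman B (fsub (lift σ) φ)) (fsub-lift-shift σ A))

friedman-[] : ∀ A φ t → friedman A (φ [ t ]) ≡ friedman (shift A) φ [ t ]
friedman-[] A φ t =
  sym (trans (fsub-friedman (sub0 t) (shift A) φ)
             (cong (λ B → friedman B (φ [ t ])) (shift-[] A t)))

friedman-stepSub : ∀ A φ → friedman (shift A) (fsub stepSub φ) ≡ fsub stepSub (friedman (shift A) φ)
friedman-stepSub A φ =
  sym (trans (fsub-friedman stepSub (shift A) φ)
             (cong (λ B → friedman B (fsub stepSub φ)) (stepSub-shift A)))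

map-friedman-shift : ∀ A Γ → map (friedman (shift A)) (map shift Γ) ≡ map shift (map (friedman A) Γ)
map-friedman-shift A = map-commute (λ γ → sym (fsub-friedman ↑ A γ))

module FriedmanSoundness {T : Theory} (HA⊆T : ∀ {φ} → HA φ → T φ) where

  friedman-stable : ∀ χ A → T ⊢ (¬¬[ A ] friedman A χ ⇒ friedman A χ)
  friedman-stable (s ≐ t) A = ¬¬-join A _
  friedman-stable ⊥'       A = ⇒I (⇒E #0 (⇒I #0))
  friedman-stable (φ ∧' ψ) A =
    ⇒I (∧I (apply (friedman-stable φ A) (⇒I (⇒E #1 (⇒I (⇒E #1 (∧E₁ #0))))))
           (apply (friedman-stable ψ A) (⇒I (⇒E #1 (⇒I (⇒E #1 (∧E₂ #0)))))))
  friedman-stable (φ ∨' ψ) A = ¬¬-join A _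
  friedman-stable (φ ⇒ ψ) A =
    ⇒I (⇒I (apply (friedman-stable ψ A) (⇒I (⇒E #2 (⇒I (⇒E #1 (⇒E #0 #2)))))))
  friedman-stable (∀' φ) A =
    ⇒I (∀I (apply (friedman-stable φ (shift A)) (⇒I (⇒E #1 (⇒I (⇒E #1 (∀E-var0 #0)))))))
  friedman-stable (∃' φ) A = ¬¬-join A _

  friedman-ex-falso : ∀ {Γ} χ A → Prf T Γ A → Prf T Γ (friedman A χ)
  friedman-ex-falso χ A p = apply (friedman-stable χ A) (⇒I (weaken-∷ p))

  friedman-HA : ∀ A {χ} → HA χ → T ⊢ friedman A χ
  friedman-HA A a@(eq-refl _)        = ⇒I (⇒E #0 (ax (HA⊆T a)))
  friedman-HA A a@(proj-def _ _)     = ⇒I (⇒E #0 (ax (HA⊆T a)))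
  friedman-HA A a@(comp-def _ _ _)   = ⇒I (⇒E #0 (ax (HA⊆T a)))
  friedman-HA A a@(rec-def₀ _ _ _)   = ⇒I (⇒E #0 (ax (HA⊆T a)))
  friedman-HA A a@(rec-defS _ _ _ _) = ⇒I (⇒E #0 (ax (HA⊆T a)))
  friedman-HA A (eq-subst φ s t) =
    ⇒I (⇒I (apply (friedman-stable (φ [ t ]) A) (⇒I (⇒E #2 (⇒I (⇒E #1 (transport #2)))))))
    where
    transport : ∀ {Γ} → Prf T ((s ≐ t) ∷ Γ) (friedman A (φ [ s ])) →
                Prf T ((s ≐ t) ∷ Γ) (friedman A (φ [ t ]))
    transport p =
      subst (Prf T _) (sym (friedman-[] A φ t))
            (⇒E (⇒E (ax (HA⊆T (eq-subst (friedman (shift A) φ) s t))) #0)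
                (subst (Prf T _) (friedman-[] A φ s) p))
  friedman-HA A (succ-nz t) = ⇒I (⇒E #0 (⇒I (⊥E (⇒E (ax (HA⊆T (succ-nz t))) #0))))
  friedman-HA A (succ-inj s t) =
    ⇒I (⇒I (⇒E #1 (⇒I (⇒E #1 (⇒E (ax (HA⊆T (succ-inj s t))) #0)))))
  friedman-HA A (ind φ) = ax (HA⊆T (subst HAax eq (ind φᴬ)))
    where
    φᴬ = friedman (shift A) φ
    eq : (φᴬ [ 𝟘 ] ⇒ ∀' (φᴬ ⇒ fsub stepSub φᴬ) ⇒ ∀' φᴬ) ≡
         friedman A (φ [ 𝟘 ] ⇒ ∀' (φ ⇒ fsub stepSub φ) ⇒ ∀' φ)
    eq = cong₂ (λ a b → a ⇒ ∀' (φᴬ ⇒ b) ⇒ ∀' φᴬ)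
               (sym (friedman-[] A φ 𝟘)) (sym (friedman-stepSub A φ))

  friedman-sound : ∀ {Γ χ} → Prf PA Γ χ → ∀ A → Prf T (map (friedman A) Γ) (friedman A χ)
  friedman-sound (ax (inj₁ a)) A = weaken-[] (friedman-HA A a)
  friedman-sound (ax (inj₂ (φ , tt , refl))) A = ⇒I (⇒E #0 (∨I₂ (⇒I (⇒E #1 (∨I₁ #0)))))
  friedman-sound (hyp m)   A = hyp (∈-map⁺ (friedman A) m)
  friedman-sound (⊥E {φ = φ} p) A = friedman-ex-falso φ A (friedman-sound p A)
  friedman-sound (∧I p q)  A = ∧I (friedman-sound p A) (friedman-sound q A)
  friedman-sound (∧E₁ p)   A = ∧E₁ (friedman-sound p A)
  friedman-sound (∧E₂ p)   A = ∧E₂ (friedman-sound p A)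
  friedman-sound (∨I₁ p)   A = ⇒I (⇒E #0 (∨I₁ (weaken-∷ (friedman-sound p A))))
  friedman-sound (∨I₂ p)   A = ⇒I (⇒E #0 (∨I₂ (weaken-∷ (friedman-sound p A))))
  friedman-sound (∨E {χ = χ} p q r) A =
    apply (friedman-stable χ A) (⇒I (⇒E (weaken-∷ (friedman-sound p A)) (⇒I (∨E #0
      (⇒E #2 (weaken-∷∷ (friedman-sound q A)))
      (⇒E #2 (weaken-∷∷ (friedman-sound r A)))))))
  friedman-sound (⇒I p)    A = ⇒I (friedman-sound p A)
  friedman-sound (⇒E p q)  A = ⇒E (friedman-sound p A) (friedman-sound q A)
  friedman-sound {Γ} (∀I {φ = φ} p) A =
    ∀I (subst (λ Δ → Prf T Δ (friedman (shift A) φ)) (map-friedman-shift A Γ)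
              (friedman-sound p (shift A)))
  friedman-sound (∀E {φ = φ} t p) A =
    subst (Prf T _) (sym (friedman-[] A φ t)) (∀E t (friedman-sound p A))
  friedman-sound (∃I {φ = φ} t p) A =
    ⇒I (⇒E #0 (∃I t (weaken-∷ (subst (Prf T _) (friedman-[] A φ t) (friedman-sound p A)))))
  friedman-sound {Γ} (∃E {φ = φ} {ψ = ψ} p q) A =
    apply (friedman-stable ψ A) (⇒I (⇒E (weaken-∷ (friedman-sound p A)) (⇒I (∃E #0
      (⇒E #2 (weaken-∷∷ q′))))))
    where
    q′ : Prf T (friedman (shift A) φ ∷ map shift (map (friedman A) Γ)) (shift (friedman A ψ))
    q′ = subst₂ (λ Δ c → Prf T (friedman (shift A) φ ∷ Δ) c)
                (map-friedman-shift A Γ) (sym (fsub-friedman ↑ A ψ)) (friedman-sound q (shift A))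

module HA+LEM-Σ (k : ℕ) where

  T : Theory
  T = HA ∪ LEM (Σ-form k)

  open FriedmanSoundness {T} inj₁

  LEM-Σ : ∀ {m χ} → m ≤ k → Σ-form m χ → T ⊢ (χ ∨' ¬' χ)
  LEM-Σ m≤k s = ax (inj₂ (_ , Σ-mono m≤k s , refl))

  LEM-QF : ∀ {χ} → QF χ → T ⊢ (χ ∨' ¬' χ)
  LEM-QF q = ax (inj₂ (_ , QF⇒Σ q , refl))

  mutual
    QF⇒friedman : ∀ {χ} → QF χ → ∀ A → T ⊢ (χ ⇒ friedman A χ)
    QF⇒friedman (qf-eq s t) A = ⇒I (⇒I (⇒E #0 #1))
    QF⇒friedman qf-⊥        A = ⇒I (⊥E #0)
    QF⇒friedman (qf-∧ a b)  A =
      ⇒I (∧I (apply (QF⇒friedman a A) (∧E₁ #0)) (apply (QF⇒friedman b A) (∧E₂ #0)))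
    QF⇒friedman (qf-∨ a b)  A =
      ⇒I (⇒I (∨E #1 (⇒E #1 (∨I₁ (apply (QF⇒friedman a A) #0)))
                    (⇒E #1 (∨I₂ (apply (QF⇒friedman b A) #0)))))
    QF⇒friedman (qf-⇒ {ψ = ψ} a b) A =
      ⇒I (⇒I (apply (friedman-stable ψ A) (⇒I (⇒E (apply (friedman⇒¬¬-QF a A) #1)
        (⇒I (⇒E #1 (apply (QF⇒friedman b A) (⇒E #3 #0))))))))

    friedman⇒¬¬-QF : ∀ {χ} → QF χ → ∀ A → T ⊢ (friedman A χ ⇒ ¬¬[ A ] χ)
    friedman⇒¬¬-QF (qf-eq s t) A = ⇒I (⇒I (⇒E #1 #0))
    friedman⇒¬¬-QF qf-⊥        A = ⇒I (⇒I #1)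
    friedman⇒¬¬-QF (qf-∧ a b)  A = ⇒I (⇒I (⇒E (apply (friedman⇒¬¬-QF a A) (∧E₁ #1))
      (⇒I (⇒E (apply (friedman⇒¬¬-QF b A) (∧E₂ #2)) (⇒I (⇒E #2 (∧I #1 #0)))))))
    friedman⇒¬¬-QF (qf-∨ a b)  A = ⇒I (⇒I (⇒E #1 (⇒I (∨E #0
      (⇒E (apply (friedman⇒¬¬-QF a A) #0) (⇒I (⇒E #3 (∨I₁ #0))))
      (⇒E (apply (friedman⇒¬¬-QF b A) #0) (⇒I (⇒E #3 (∨I₂ #0))))))))
    friedman⇒¬¬-QF (qf-⇒ a b)  A = ⇒I (⇒I (∨E (weaken-[] (LEM-QF a))
      (⇒E (apply (friedman⇒¬¬-QF b A) (⇒E #2 (apply (QF⇒friedman a A) #0))) (⇒I (⇒E #2 (⇒I #1))))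
      (⇒E #1 (⇒I (⊥E (⇒E #1 #0))))))

  mutual
    Σ⇒friedman : ∀ {m χ} → Σ-form m χ → ∀ A → T ⊢ (χ ⇒ friedman A χ)
    Σ⇒friedman (Σ-qf q)    A = QF⇒friedman q A
    Σ⇒friedman (Σ-block p) A = Π⇒friedman p A
    Σ⇒friedman (Σ-∃ s)     A =
      ⇒I (⇒I (∃E #1 (⇒E #1 (∃I-var0 (apply (Σ⇒friedman s (shift A)) #0)))))

    Π⇒friedman : ∀ {m χ} → Π-form m χ → ∀ A → T ⊢ (χ ⇒ friedman A χ)
    Π⇒friedman (Π-qf q)    A = QF⇒friedman q A
    Π⇒friedman (Π-block s) A = Σ⇒friedman s A
    Π⇒friedman (Π-∀ p)     A = ⇒I (∀I (apply (Π⇒friedman p (shift A)) (∀E-var0 #0)))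

  Prenex⇒friedman : ∀ {χ} → Prenex χ → ∀ A → T ⊢ (χ ⇒ friedman A χ)
  Prenex⇒friedman (m , inj₁ s) = Σ⇒friedman s
  Prenex⇒friedman (m , inj₂ p) = Π⇒friedman p

  mutual
    Π-split : ∀ {m θ} → suc m ≤ k → Π-form (suc m) θ → T ⊢ (∃' (dual θ) ∨' ∀' θ)
    Π-split m<k p = ∨E (LEM-Σ m<k (Σ-∃ (dual-Π p))) (∨I₁ #0)
      (∨I₂ (∀I (apply (¬dual⇒Π m<k p) (⇒I (⇒E #1 (∃I-var0 #0))))))

    ¬dual⇒Π : ∀ {m θ} → m ≤ k → Π-form m θ → T ⊢ (¬' (dual θ) ⇒ θ)
    ¬dual⇒Π m≤k p = ⇒I (∨E (weaken-[] (LEM-Π m≤k p)) #0 (⊥E (⇒E #1 (apply (¬Π⇒dual m≤k p) #0))))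

    LEM-Π : ∀ {m θ} → m ≤ k → Π-form m θ → T ⊢ (θ ∨' ¬' θ)
    LEM-Π m≤k (Π-qf q)    = LEM-QF q
    LEM-Π m≤k (Π-block s) = LEM-Σ (<⇒≤ m≤k) s
    LEM-Π m≤k (Π-∀ {φ = θ} p) =
      ∨E (weaken-[] (Π-split m≤k p)) (∨I₂ (apply (dual⇒¬ (∀' θ)) #0)) (∨I₁ #0)

    ¬Π⇒dual : ∀ {m θ} → m ≤ k → Π-form m θ → T ⊢ (¬' θ ⇒ dual θ)
    ¬Π⇒dual m≤k (Π-qf q)    = ¬⇒dual-QF q
    ¬Π⇒dual m≤k (Π-block s) = ¬Σ⇒dual (<⇒≤ m≤k) s
    ¬Π⇒dual m≤k (Π-∀ p)     = ⇒I (∨E (weaken-[] (Π-split m≤k p)) #0 (⊥E (⇒E #1 #0)))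

    ¬Σ⇒dual : ∀ {m θ} → m ≤ k → Σ-form m θ → T ⊢ (¬' θ ⇒ dual θ)
    ¬Σ⇒dual m≤k (Σ-qf q)    = ¬⇒dual-QF q
    ¬Σ⇒dual m≤k (Σ-block p) = ¬Π⇒dual (<⇒≤ m≤k) p
    ¬Σ⇒dual m≤k (Σ-∃ s)     = ⇒I (∀I (apply (¬Σ⇒dual m≤k s) (⇒I (⇒E #1 (∃I-var0 #0)))))

  mutual
    friedman⇒¬¬-Π : ∀ {m θ} → m ≤ k → Π-form m θ → ∀ A → T ⊢ (friedman A θ ⇒ ¬¬[ A ] θ)
    friedman⇒¬¬-Π m≤k (Π-qf q)    A = friedman⇒¬¬-QF q A
    friedman⇒¬¬-Π m≤k (Π-block s) A = friedman⇒¬¬-Σ (m≤n⇒m≤1+n (<⇒≤ m≤k)) s A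
    friedman⇒¬¬-Π m≤k (Π-∀ {φ = θ} p) A = ⇒I (⇒I (∨E (weaken-[] (Π-split m≤k p))
      (∃E #0 (⇒E (apply (friedman⇒¬¬-Π m≤k p (shift A)) (∀E-var0 #3))
                 (⇒I (⊥E (⇒E (apply (dual⇒¬ θ) #1) #0)))))
      (⇒E #1 #0)))

    friedman⇒¬¬-Σ : ∀ {m θ} → m ≤ suc k → Σ-form m θ → ∀ A → T ⊢ (friedman A θ ⇒ ¬¬[ A ] θ)
    friedman⇒¬¬-Σ m≤1+k (Σ-qf q)    A = friedman⇒¬¬-QF q A
    friedman⇒¬¬-Σ m≤1+k (Σ-block p) A = friedman⇒¬¬-Π (≤-pred m≤1+k) p A
    friedman⇒¬¬-Σ m≤1+k (Σ-∃ s)     A = ⇒I (⇒I (⇒E #1 (⇒I (∃E #0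
      (⇒E (apply (friedman⇒¬¬-Σ m≤1+k s (shift A)) #0) (⇒I (⇒E #3 (∃I-var0 #0))))))))

  Σ-conservative : ∀ {φ ψ} → Σ-form (suc k) φ → Prenex ψ → PA ⊢ (ψ ⇒ φ) → T ⊢ (ψ ⇒ φ)
  Σ-conservative {φ} s ψ-prenex d =
    ⇒I (⇒E (apply (friedman⇒¬¬-Σ ≤-refl s φ)
                  (apply (friedman-sound d φ) (apply (Prenex⇒friedman ψ-prenex φ) #0)))
           (⇒I #0))

  Π-conservative : ∀ {φ ψ} → Π-form (suc (suc k)) φ → Prenex ψ → PA ⊢ (ψ ⇒ φ) → T ⊢ (ψ ⇒ φ)
  Π-conservative (Π-block s) ψ-prenex d = Σ-conservative s ψ-prenex d
  Π-conservative (Π-∀ p)     ψ-prenex d =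
    ⇒∀⁺ (Π-conservative p (Prenex-fsub ↑ ψ-prenex) (⇒∀⁻ PA-fsub d))

theorem6p14 : (k : ℕ) (φ ψ : Formula) → Π-form (suc (suc k)) φ → Prenex ψ →
    PA ⊢ (ψ ⇒ φ) → (HA ∪ LEM (Σ-form k)) ⊢ (ψ ⇒ φ)
theorem6p14 k φ ψ = HA+LEM-Σ.Π-conservative k
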